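{- Let $n>4$. In any sparse ordering $\sigma$ of $U_n$, the position of $v_1$ is either $1$ or $2$, and the position of $v_n$ is either $n$ or $n-1$. Furthermore, for no $i\in\{1,\dots,n-1\}$ do $v_i$ and $v_{i+1}$ appear consecutively in $\sigma$ in the order $\langle v_i,v_{i+1}\rangle$.
   Context: For $n\ge1$, $U_n$ is the tournament with vertex set $\{v_1,\dots,v_n\}$ and arc set $\{(v_{i+1},v_i): 1\le i\le n-1\}\cup\{(v_i,v_j): 1\le i<n,\ i+1<j\le n\}$. Given an ordering $\langle w_1,\dots,w_n\rangle$ of the vertices, an arc $(w_i,w_j)$ is backward if $j<i$. An ordering is sparse if every vertex is incident to at most one backward arc. -}

module Defs where

open import Data.Nat using (ℕ; suc; _<_; _+_)
open import Data.Fin using (Fin; toℕ)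
open import Data.Sum using (_⊎_)
open import Data.Product using (_×_)
open import Relation.Binary.PropositionalEquality using (_≡_)
open import Function.Bundles using (_↔_)

-- Vertex v_{k+1} of U_n is represented by k : Fin n.
-- Arc relation of U_n:  (v_{i+1}, v_i)  and  (v_i, v_j) for i+1 < j.
Arc : (n : ℕ) → Fin n → Fin n → Set
Arc n a b = (toℕ a ≡ suc (toℕ b)) ⊎ (suc (toℕ a) < toℕ b)

-- An ordering <w_1,...,w_n> is a bijection from positions (Fin n, 0-indexed)
-- to vertices: w_{p+1} = Inverse.to σ p.
Ordering : ℕ → Set
Ordering n = Fin n ↔ Fin n

module _ {n : ℕ} (σ : Ordering n) where
  open Function.Bundles.Inverse σ renaming (to to w)

  Backward : Fin n → Fin n → Set
  Backward p q = (toℕ q < toℕ p) × Arc n (w p) (w q)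

  IncidentBackward : Fin n → Fin n → Set
  IncidentBackward x y = Backward x y ⊎ Backward y x

  Sparse : Set
  Sparse = ∀ x y z → IncidentBackward x y → IncidentBackward x z → y ≡ z

{-# OPTIONS --safe #-}
module Submission where

-- U_n has so many arcs that sparseness pins down its ends.  If v_1 came after the
-- first two positions, they would have to hold v_2 and some v_d with d ≥ 3 (otherwise
-- the position of v_1 gets two backward arcs); but then the position of v_d receives
-- a backward arc from v_1 and a second one from a vertex v_e, e ≥ 3, with (v_e, v_d)
-- an arc, which must lie later.  Relabelling v_i ↦ v_{n+1-i} reverses every arc of
-- U_n, so together with reversing the ordering it preserves backward arcs and
-- sparseness; this reduces the claim about v_n to the one about v_1.  Finally, if v_i,
-- v_{i+1} are consecutive, the backward arc between them leaves no room for a vertex c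
-- with arcs v_i → c → v_{i+1} (c = v_{i-1}, or v_3 when i = 1): wherever c stands, it
-- gives one of the two positions a second backward arc.

open import Defs
open import Data.Nat using (ℕ; zero; suc; z<s; _+_; _<_; _≤_; _∸_; z≤n; s≤s; _≤?_)
open import Data.Nat.Properties
open import Data.Fin using (Fin; zero; suc; toℕ; fromℕ<; opposite)
open import Data.Fin.Properties
  using (toℕ-fromℕ<; toℕ-injective; toℕ<n; toℕ≤pred[n]; opposite-prop; opposite-involutive)
open import Data.Fin.Permutation using (reverse; _∘ₚ_)
open import Data.Product using (_×_; _,_; ∃-syntax)
open import Data.Sum using (_⊎_; inj₁; inj₂; swap; map)
open import Data.Empty using (⊥; ⊥-elim)
open import Function using (_∘_)
open import Relation.Binary.PropositionalEquality using (_≡_; _≢_; refl; sym; trans; cong; subst; module ≡-Reasoning)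
open import Relation.Binary.Definitions using (tri<; tri≈; tri>)
open import Relation.Nullary using (¬_; yes; no)
open import Function.Bundles using (module Inverse)

-- Arc n a b unfolds to Arcℕ (toℕ a) (toℕ b), so arcs are produced by arithmetic on labels.
Arcℕ : ℕ → ℕ → Set
Arcℕ a b = a ≡ suc b ⊎ suc a < b

Arcℕ⇒≢ : ∀ {a b} → Arcℕ a b → a ≢ b
Arcℕ⇒≢ (inj₁ a≡1+a) refl = 1+n≢n (sym a≡1+a)
Arcℕ⇒≢ (inj₂ 1+a<a) refl = 1+n≰n (<⇒≤ 1+a<a)

Arcℕ-complement : ∀ {x y a b} → x + a ≡ y + b → Arcℕ x y → Arcℕ b a
Arcℕ-complement {x} {y} {a} {b} eq (inj₁ refl) =
  inj₁ (sym (+-cancelˡ-≡ y (suc a) b (trans (+-suc y a) eq)))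
Arcℕ-complement {x} {y} {a} {b} eq (inj₂ 1+x<y) = inj₂ (+-cancelˡ-< y (suc b) a (begin-strict
  y + suc b   ≡⟨ +-suc y b ⟩
  suc (y + b) ≡⟨ cong suc eq ⟨
  suc x + a   <⟨ +-monoˡ-< a 1+x<y ⟩
  y + a       ∎))
  where open ≤-Reasoning

<-complement : ∀ {x y a b} → x + a ≡ y + b → a < b → y < x
<-complement {x} {y} {a} {b} eq a<b = +-cancelʳ-< a y x (begin-strict
  y + a <⟨ +-monoʳ-< y a<b ⟩
  y + b ≡⟨ eq ⟨
  x + a ∎)
  where open ≤-Reasoning

arcInto : ∀ {n} d → 4 < n → 2 ≤ d → ∃[ e ] 2 ≤ e × e < n × Arcℕ e d
arcInto 0 _ ()
arcInto 1 _ (s≤s ())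
arcInto 2 4<n _ = 3 , s≤s (s≤s z≤n) , <-trans (n<1+n 3) 4<n , inj₁ refl
arcInto 3 4<n _ = 4 , s≤s (s≤s z≤n) , 4<n , inj₁ refl
arcInto (suc (suc (suc (suc d)))) 4<n _ =
  2 , ≤-refl , <-trans (s≤s (s≤s (s≤s z≤n))) 4<n , inj₂ (s≤s (s≤s (s≤s (s≤s z≤n))))

arcsAround : ∀ {n} b → 2 < n → suc b < n → ∃[ c ] c < n × Arcℕ b c × Arcℕ c (suc b)
arcsAround zero    2<n _      = 2 , 2<n , inj₂ ≤-refl , inj₁ refl
arcsAround (suc a) _   2+a<n = a , <-trans (n<1+n a) (<-trans (n<1+n (suc a)) 2+a<n) , inj₁ refl , inj₂ ≤-refl

opposite-+ : ∀ {n} (i : Fin n) → toℕ (opposite i) + toℕ i ≡ n ∸ 1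
opposite-+ {suc n} i = trans (cong (_+ toℕ i) (opposite-prop i)) (m∸n+n≡m (toℕ≤pred[n] i))

module SparseOrdering {n : ℕ} (σ : Ordering n) (sparse : Sparse σ) where
  open Inverse σ

  vertex : Fin n → ℕ
  vertex p = toℕ (to p)

  vertex-injective : ∀ {p q} → vertex p ≡ vertex q → toℕ p ≡ toℕ q
  vertex-injective {p} {q} eq =
    cong toℕ (trans (sym (strictlyInverseʳ p)) (trans (cong from (toℕ-injective eq)) (strictlyInverseʳ q)))

  vertex-≢ : ∀ {p q a b} → vertex p ≡ a → vertex q ≡ b → a ≢ b → toℕ p ≢ toℕ q
  vertex-≢ refl refl a≢b = a≢b ∘ cong toℕ ∘ cong to ∘ toℕ-injective

  positionOf : ∀ k → k < n → Fin n
  positionOf k k<n = from (fromℕ< k<n)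

  vertex-positionOf : ∀ k (k<n : k < n) → vertex (positionOf k k<n) ≡ k
  vertex-positionOf k k<n = trans (cong toℕ (strictlyInverseˡ _)) (toℕ-fromℕ< k<n)

  backward : ∀ {p q a b} → toℕ q < toℕ p → vertex p ≡ a → vertex q ≡ b → Arcℕ a b → Backward σ p q
  backward q<p refl refl arc = q<p , arc

  noConsecutiveAscent : 2 < n → ∀ p q → toℕ q ≡ suc (toℕ p) → vertex q ≡ suc (vertex p) → ⊥
  noConsecutiveAscent 2<n p q q≡1+p wq≡1+wp
    with c , c<n , arc-pc , arc-cq ← arcsAround (vertex p) 2<n (subst (_< n) wq≡1+wp (toℕ<n (to q)))
    = placed (positionOf c c<n) (vertex-positionOf c c<n)
    where
    p<q : toℕ p < toℕ q
    p<q = subst (toℕ p <_) (sym q≡1+p) (n<1+n (toℕ p))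

    qp : Backward σ q p
    qp = backward p<q wq≡1+wp refl (inj₁ refl)

    placed : ∀ r → vertex r ≡ c → ⊥
    placed r wr with <-cmp (toℕ r) (toℕ p)
    ... | tri< r<p _ _ =
      <⇒≢ (<-trans r<p p<q) (cong toℕ (sparse p r q (inj₁ (backward r<p refl wr arc-pc)) (inj₂ qp)))
    ... | tri≈ _ r≡p _ = vertex-≢ refl wr (Arcℕ⇒≢ arc-pc) (sym r≡p)
    ... | tri> _ _ p<r =
      <⇒≢ p<r (sym (cong toℕ (sparse q r p (inj₂ (backward q<r wr wq≡1+wp arc-cq)) (inj₁ qp))))
      where
      q<r : toℕ q < toℕ r
      q<r = ≤∧≢⇒< (subst (_≤ toℕ r) (sym q≡1+p) p<r) (vertex-≢ wq≡1+wp wr (Arcℕ⇒≢ arc-cq ∘ sym))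

module FrontOfSparseOrdering {m : ℕ} (σ : Ordering (2 + m)) (sparse : Sparse σ) (2<m : 2 < m) where
  open Inverse σ
  open SparseOrdering σ sparse

  frontPosition : ∀ (t : Fin (2 + m)) → toℕ t < 2 → t ≡ zero ⊎ t ≡ suc zero
  frontPosition zero          _ = inj₁ refl
  frontPosition (suc zero)    _ = inj₂ refl
  frontPosition (suc (suc _)) (s≤s (s≤s ()))

  zeroNotLate-frontHasOne : ∀ {d} (r : Fin m) (s s' : Fin (2 + m)) →
    (∀ t → toℕ t < 2 → t ≡ s ⊎ t ≡ s') → toℕ s < 2 →
    vertex s ≡ d → 2 ≤ d → vertex s' ≡ 1 → vertex (suc (suc r)) ≡ 0 → ⊥
  zeroNotLate-frontHasOne {d} r s s' cover s<2 ws 2≤d ws' wr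
    with e , 2≤e , e<n , arc-ed ← arcInto d (s≤s (s≤s 2<m)) 2≤d
    = vertex-≢ wr (vertex-positionOf e e<n) (<⇒≢ (<-≤-trans z<s 2≤e))
        (cong toℕ (sparse s (suc (suc r)) t
          (inj₂ (backward (<-≤-trans s<2 (s≤s (s≤s z≤n))) wr ws (inj₂ 2≤d)))
          (inj₂ (backward (<-≤-trans s<2 2≤t) (vertex-positionOf e e<n) ws arc-ed))))
    where
    t : Fin (2 + m)
    t = positionOf e e<n

    2≤t : 2 ≤ toℕ t
    2≤t with 2 ≤? toℕ t
    ... | yes 2≤t = 2≤t
    ... | no 2≰t with cover t (≰⇒> 2≰t)
    ... | inj₁ refl = ⊥-elim (Arcℕ⇒≢ arc-ed (trans (sym (vertex-positionOf e e<n)) ws))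
    ... | inj₂ refl = ⊥-elim (<⇒≢ 2≤e (trans (sym ws') (vertex-positionOf e e<n)))

  zeroNotLate : ∀ (r : Fin m) → vertex (suc (suc r)) ≢ 0
  zeroNotLate r wr with vertex zero in w₀ | vertex (suc zero) in w₁
  ... | zero     | _        = 1+n≢0 (vertex-injective {suc (suc r)} {zero} (trans wr (sym w₀)))
  ... | _        | zero     = 1+n≢0 (suc-injective (vertex-injective {suc (suc r)} {suc zero} (trans wr (sym w₁))))
  ... | suc zero | suc zero = 0≢1+n (vertex-injective {zero} {suc zero} (trans w₀ (sym w₁)))
  ... | suc zero    | suc (suc _) =
    zeroNotLate-frontHasOne r (suc zero) zero (λ t → swap ∘ frontPosition t) ≤-refl w₁ (s≤s (s≤s z≤n)) w₀ wr
  ... | suc (suc _) | suc zero    =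
    zeroNotLate-frontHasOne r zero (suc zero) frontPosition (s≤s z≤n) w₀ (s≤s (s≤s z≤n)) w₁ wr
  ... | suc (suc _) | suc (suc _) = 0≢1+n (cong toℕ (sparse (suc (suc r)) zero (suc zero)
    (inj₁ (backward (s≤s z≤n) wr w₀ (inj₂ (s≤s (s≤s z≤n)))))
    (inj₁ (backward (s≤s (s≤s z≤n)) wr w₁ (inj₂ (s≤s (s≤s z≤n)))))))

  firstVertex-front : ∀ v → toℕ v ≡ 0 → toℕ (from v) ≡ 0 ⊎ toℕ (from v) ≡ 1
  firstVertex-front v v≡0 = placed (from v) (trans (cong toℕ (strictlyInverseˡ v)) v≡0)
    where
    placed : ∀ r → vertex r ≡ 0 → toℕ r ≡ 0 ⊎ toℕ r ≡ 1
    placed zero          _  = inj₁ refl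
    placed (suc zero)    _  = inj₂ refl
    placed (suc (suc r)) wr = ⊥-elim (zeroNotLate r wr)

mirror : ∀ {n} → Ordering n → Ordering n
mirror σ = reverse ∘ₚ σ ∘ₚ reverse

module _ {n : ℕ} (σ : Ordering n) where
  open Inverse σ

  mirror-backward : ∀ {p q} → Backward (mirror σ) p q → Backward σ (opposite q) (opposite p)
  mirror-backward {p} {q} (q<p , arc) =
      <-complement (trans (opposite-+ q) (sym (opposite-+ p))) q<p
    , Arcℕ-complement (trans (opposite-+ (to (opposite p))) (sym (opposite-+ (to (opposite q))))) arc

  mirror-incident : ∀ {x y} → IncidentBackward (mirror σ) x y → IncidentBackward σ (opposite x) (opposite y)
  mirror-incident = swap ∘ map mirror-backward mirror-backward

  Sparse-mirror : Sparse σ → Sparse (mirror σ)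
  Sparse-mirror sparse x y z x~y x~z = begin
    y                     ≡⟨ opposite-involutive y ⟨
    opposite (opposite y) ≡⟨ cong opposite opposites-equal ⟩
    opposite (opposite z) ≡⟨ opposite-involutive z ⟩
    z                     ∎
    where
    open ≡-Reasoning
    opposites-equal : opposite y ≡ opposite z
    opposites-equal = sparse (opposite x) (opposite y) (opposite z) (mirror-incident x~y) (mirror-incident x~z)

lastVertex-back : ∀ {m} (σ : Ordering (2 + m)) → Sparse σ → 2 < m → ∀ v → toℕ v ≡ suc m →
  toℕ (Inverse.from σ v) ≡ suc m ⊎ toℕ (Inverse.from σ v) ≡ m
lastVertex-back {m} σ sparse 2<m v v≡1+m =
  map complement (suc-injective ∘ complement) mirrored
  where
  open Inverse σ

  complement : ∀ {k} → toℕ (opposite (from v)) ≡ k → k + toℕ (from v) ≡ suc m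
  complement refl = opposite-+ (from v)

  opposite-v≡0 : toℕ (opposite v) ≡ 0
  opposite-v≡0 = +-cancelʳ-≡ (suc m) (toℕ (opposite v)) 0
    (trans (cong (toℕ (opposite v) +_) (sym v≡1+m)) (opposite-+ v))

  mirrored : toℕ (opposite (from v)) ≡ 0 ⊎ toℕ (opposite (from v)) ≡ 1
  mirrored = subst (λ u → toℕ (opposite (from u)) ≡ 0 ⊎ toℕ (opposite (from u)) ≡ 1) (opposite-involutive v)
    (FrontOfSparseOrdering.firstVertex-front (mirror σ) (Sparse-mirror σ sparse) 2<m (opposite v) opposite-v≡0)

mainTheorem7 : (n : ℕ) → 4 < n → (σ : Ordering n) → Sparse σ →
    ((v : Fin n) → toℕ v ≡ 0 →
      (toℕ (Inverse.from σ v) ≡ 0) ⊎ (toℕ (Inverse.from σ v) ≡ 1))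
    × ((v : Fin n) → toℕ v ≡ n ∸ 1 →
      (toℕ (Inverse.from σ v) ≡ n ∸ 1) ⊎ (toℕ (Inverse.from σ v) ≡ n ∸ 2))
    × ((p q : Fin n) → toℕ q ≡ suc (toℕ p) →
      ¬ (toℕ (Inverse.to σ q) ≡ suc (toℕ (Inverse.to σ p))))
mainTheorem7 _ (s≤s (s≤s 2<m)) σ sparse =
    FrontOfSparseOrdering.firstVertex-front σ sparse 2<m
  , lastVertex-back σ sparse 2<m
  , SparseOrdering.noConsecutiveAscent σ sparse (m≤n⇒m≤o+n 2 2<m)
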